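{- Let $n$ be a positive integer, $\mathbf F_n=\mathbf F(X)$ the free lattice on $X=\{x_1,\dots,x_n\}$, and $\mathbf K$ an elementary extension of $\mathbf F_n$ (in the language $\{\vee,\wedge\}$). Let $\mathbf L$ be a finite lattice which is both lower and upper bounded and is generated by $\{a_1,\dots,a_n\}$, and let $f:\mathbf F_n\to\mathbf L$ be the homomorphism with $x_i\mapsto a_i$. Then for each $a\in L$ the preimage $f^{ -1}(a)$ is an interval $[\beta(a),\alpha(a)]$ of $\mathbf F_n$, and the map $\hat f:\mathbf K\to\mathbf L$ defined by $\hat f(u)=a$ iff $\beta(a)\le u\le \alpha(a)$ in $\mathbf K$ is a well-defined lattice homomorphism extending $f$. Furthermore, letting $\hat h_k:\mathbf K\to\mathbf B_{(n,k)}$ be the map so obtained from the canonical homomorphism $h_k:\mathbf F_n\to\mathbf B_{(n,k)}$, the family $(\mathbf K,\hat h_k:k<\omega)$ is a cone over the inverse system $(\mathbf B_{(n,k)},f_{(k,\ell)})$, i.e. $f_{(k,\ell)}\circ\hat h_\ell=\hat h_k$ for $k<\ell$; hence there is a homomorphism $h:\mathbf K\to\mathbf H_n$ whose composition with each projection $\mathbf H_n\to\mathbf B_{(n,k)}$ is $\hat h_k$.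
   Context: A lattice homomorphism $g:\mathbf M\to\mathbf L$ is lower bounded if for every $a\in L$ the set $\{u\in M: g(u)\ge a\}$ is empty or has a least element; upper bounded is the dual; bounded means both. A finitely generated lattice $\mathbf L$ is lower (upper) bounded if every homomorphism from a finitely generated lattice into $\mathbf L$ is lower (upper) bounded. A join cover of $a$ is a finite set $V$ with $a\le\bigvee V$; it is nontrivial if $a\not\le v$ for all $v\in V$; $U$ refines $V$ if every $u\in U$ lies below some $v\in V$. $D_0(\mathbf L)$ is the set of elements with no nontrivial join cover (the join prime elements), and $a\in D_k(\mathbf L)$ ($k>0$) if every nontrivial join cover of $a$ has a refinement contained in $D_{k-1}(\mathbf L)$ that is also a join cover of $a$. A finitely generated lattice is lower bounded iff $\bigcup_k D_k(\mathbf L)=L$; the $D$-rank of an element is the least such $k$, and the $D$-rank of $\mathbf L$ is the supremum of the $D$-ranks of its join irreducible elements; $D^{\mathrm{op}}$-rank is the dual notion. For $k<\omega$, $\mathcal V_k$ is the class of lattices all of whose finitely generated sublattices are lower and upper bounded with $D$-rank and $D^{\mathrm{op}}$-rank $\le k$; this is a variety (Nation), and $\mathcal V_k\subseteq\mathcal V_\ell$ for $k<\ell$. $\mathbf B_{(n,k)}$ is the free lattice of rank $n$ in $\mathcal V_k$ (a finite bounded lattice), $h_k:\mathbf F_n\to\mathbf B_{(n,k)}$ the canonical surjection, and for $k<\ell$, $f_{(k,\ell)}:\mathbf B_{(n,\ell)}\to\mathbf B_{(n,k)}$ the canonical surjection. $\mathbf H_n$, the profinite-bounded completion of $\mathbf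 F_n$, is the inverse limit of this inverse system. -}

module Defs where

open import Level using (0ℓ) renaming (suc to lsuc)
open import Data.Nat using (ℕ; zero; suc; _≤_; _<_)
open import Data.Fin using (Fin)
open import Data.Product using (Σ; _×_; _,_; proj₁; proj₂)
open import Data.Sum using (_⊎_)
open import Data.Empty using (⊥)
open import Data.List using (List; []; _∷_)
open import Data.List.NonEmpty using (List⁺; toList) renaming (_∷_ to _∷⁺_)
open import Data.List.Relation.Unary.All using (All)
open import Data.List.Relation.Unary.Any using (Any)
open import Data.Vec.Functional using () renaming (_∷_ to _∷ᵥ_)
open import Function using (_∘_)
open import Relation.Nullary using (¬_)
open import Relation.Binary.Structures using (IsEquivalence)
open import Algebra.Lattice.Bundles using (Lattice)
open import Algebra.Lattice.Structures using (IsLattice)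
open import Algebra.Lattice.Morphism.Structures using (module LatticeMorphisms)
import Algebra.Lattice.Properties.Lattice as LP

Lat : Set₁
Lat = Lattice 0ℓ 0ℓ

Leq : (L : Lat) → Lattice.Carrier L → Lattice.Carrier L → Set
Leq L x y = Lattice._≈_ L (Lattice._∧_ L x y) x

syntax Leq L x y = x ≤⟨ L ⟩ y

open Lattice using (Carrier)

dual : Lat → Lat
dual L = LP.∧-∨-lattice L

IsHom : (M L : Lat) → (Carrier M → Carrier L) → Set
IsHom M L f =
  LatticeMorphisms.IsLatticeHomomorphism (Lattice.rawLattice M) (Lattice.rawLattice L) f

infixr 6 _∨ₜ_
infixr 7 _∧ₜ_
data Term (m : ℕ) : Set where
  var   : Fin m → Term m
  _∨ₜ_  : Term m → Term m → Term m
  _∧ₜ_  : Term m → Term m → Term m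

eval : (L : Lat) {m : ℕ} → (Fin m → Carrier L) → Term m → Carrier L
eval L g (var i)  = g i
eval L g (t ∨ₜ s) = Lattice._∨_ L (eval L g t) (eval L g s)
eval L g (t ∧ₜ s) = Lattice._∧_ L (eval L g t) (eval L g s)

GeneratedBy : (L : Lat) {m : ℕ} → (Fin m → Carrier L) → Set
GeneratedBy L g = ∀ x → Σ (Term _) λ t → Lattice._≈_ L (eval L g t) x

FinitelyGenerated : Lat → Set
FinitelyGenerated L = Σ ℕ λ m → Σ (Fin m → Carrier L) λ g → GeneratedBy L g

Finite : Lat → Set
Finite L = Σ ℕ λ m → Σ (Fin m → Carrier L) λ e →
  ∀ x → Σ (Fin m) λ i → Lattice._≈_ L (e i) x

module _ {n : ℕ} where
  infix 4 _≃_
  data _≃_ : Term n → Term n → Set where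
    ≃-refl  : ∀ {x} → x ≃ x
    ≃-sym   : ∀ {x y} → x ≃ y → y ≃ x
    ≃-trans : ∀ {x y z} → x ≃ y → y ≃ z → x ≃ z
    ≃∨-comm  : ∀ x y → (x ∨ₜ y) ≃ (y ∨ₜ x)
    ≃∨-assoc : ∀ x y z → ((x ∨ₜ y) ∨ₜ z) ≃ (x ∨ₜ (y ∨ₜ z))
    ≃∨-cong  : ∀ {x y u v} → x ≃ y → u ≃ v → (x ∨ₜ u) ≃ (y ∨ₜ v)
    ≃∧-comm  : ∀ x y → (x ∧ₜ y) ≃ (y ∧ₜ x)
    ≃∧-assoc : ∀ x y z → ((x ∧ₜ y) ∧ₜ z) ≃ (x ∧ₜ (y ∧ₜ z))
    ≃∧-cong  : ∀ {x y u v} → x ≃ y → u ≃ v → (x ∧ₜ u) ≃ (y ∧ₜ v)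
    ≃∨-abs-∧ : ∀ x y → (x ∨ₜ (x ∧ₜ y)) ≃ x
    ≃∧-abs-∨ : ∀ x y → (x ∧ₜ (x ∨ₜ y)) ≃ x

FreeLattice : ℕ → Lat
FreeLattice n = record
  { Carrier = Term n
  ; _≈_ = _≃_
  ; _∨_ = _∨ₜ_
  ; _∧_ = _∧ₜ_
  ; isLattice = record
    { isEquivalence = record { refl = ≃-refl ; sym = ≃-sym ; trans = ≃-trans }
    ; ∨-comm = ≃∨-comm ; ∨-assoc = ≃∨-assoc ; ∨-cong = ≃∨-cong
    ; ∧-comm = ≃∧-comm ; ∧-assoc = ≃∧-assoc ; ∧-cong = ≃∧-cong
    ; absorptive = ≃∨-abs-∧ , ≃∧-abs-∨
    }
  }

LowerBoundedHom : (M L : Lat) → (Carrier M → Carrier L) → Set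
LowerBoundedHom M L f = ∀ (a : Carrier L) →
  (∀ u → ¬ (a ≤⟨ L ⟩ f u))
  ⊎ Σ (Carrier M) λ u₀ → (a ≤⟨ L ⟩ f u₀) × (∀ u → a ≤⟨ L ⟩ f u → u₀ ≤⟨ M ⟩ u)

UpperBoundedHom : (M L : Lat) → (Carrier M → Carrier L) → Set
UpperBoundedHom M L f = LowerBoundedHom (dual M) (dual L) f

LowerBoundedLat : Lat → Set₁
LowerBoundedLat L = ∀ (M : Lat) → FinitelyGenerated M →
  ∀ f → IsHom M L f → LowerBoundedHom M L f

UpperBoundedLat : Lat → Set₁
UpperBoundedLat L = ∀ (M : Lat) → FinitelyGenerated M →
  ∀ f → IsHom M L f → UpperBoundedHom M L f

module _ (L : Lat) where
  open Lattice L hiding (Carrier)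

  join₁ : (Carrier L) → List (Carrier L) → (Carrier L)
  join₁ x []       = x
  join₁ x (y ∷ ys) = x ∨ join₁ y ys

  ⋁ : List⁺ (Carrier L) → (Carrier L)
  ⋁ (x ∷⁺ xs) = join₁ x xs

  JoinCover : (Carrier L) → List⁺ (Carrier L) → Set
  JoinCover a V = a ≤⟨ L ⟩ ⋁ V

  Nontrivial : (Carrier L) → List⁺ (Carrier L) → Set
  Nontrivial a V = All (λ v → ¬ (a ≤⟨ L ⟩ v)) (toList V)

  Refines : List⁺ (Carrier L) → List⁺ (Carrier L) → Set
  Refines U V = All (λ u → Any (λ v → u ≤⟨ L ⟩ v) (toList V)) (toList U)

  D : ℕ → (Carrier L) → Set
  D zero a = ∀ V → JoinCover a V → ¬ Nontrivial a V
  D (suc k) a = ∀ V → JoinCover a V → Nontrivial a V →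
    Σ (List⁺ (Carrier L)) λ U → Refines U V × All (D k) (toList U) × JoinCover a U

  JoinIrreducible : (Carrier L) → Set
  JoinIrreducible a = (¬ (∀ x → a ≤⟨ L ⟩ x)) × (∀ x y → a ≈ (x ∨ y) → (a ≈ x) ⊎ (a ≈ y))

  DRankLE : ℕ → Set
  DRankLE k = ∀ a → JoinIrreducible a → Σ ℕ λ j → j ≤ k × D j a

Sub : (L : Lat) {m : ℕ} → (Fin m → Carrier L) → Lat
Sub L {m} g = record
  { Carrier = Σ C λ x → Σ (Term m) λ t → eval L g t ≈ x
  ; _≈_ = λ x y → proj₁ x ≈ proj₁ y
  ; _∨_ = λ { (x , t , p) (y , s , q) → (x ∨ y , t ∨ₜ s , ∨-cong p q) }
  ; _∧_ = λ { (x , t , p) (y , s , q) → (x ∧ y , t ∧ₜ s , ∧-cong p q) }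
  ; isLattice = record
    { isEquivalence = record { refl = refl ; sym = sym ; trans = trans }
    ; ∨-comm = λ x y → ∨-comm (proj₁ x) (proj₁ y)
    ; ∨-assoc = λ x y z → ∨-assoc (proj₁ x) (proj₁ y) (proj₁ z)
    ; ∨-cong = ∨-cong
    ; ∧-comm = λ x y → ∧-comm (proj₁ x) (proj₁ y)
    ; ∧-assoc = λ x y z → ∧-assoc (proj₁ x) (proj₁ y) (proj₁ z)
    ; ∧-cong = ∧-cong
    ; absorptive = (λ x y → proj₁ absorptive (proj₁ x) (proj₁ y))
                 , (λ x y → proj₂ absorptive (proj₁ x) (proj₁ y))
    }
  }
  where open Lattice L renaming (Carrier to C)

InV : ℕ → Lat → Set₁
InV k L = ∀ (m : ℕ) (g : Fin m → Carrier L) →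
  LowerBoundedLat (Sub L g) × UpperBoundedLat (Sub L g)
  × DRankLE (Sub L g) k × DRankLE (dual (Sub L g)) k

IsFreeInV : ℕ → (n : ℕ) → (B : Lat) → (Fin n → Carrier B) → Set₁
IsFreeInV k n B g = InV k B × GeneratedBy B g ×
  (∀ (M : Lat) → InV k M → (c : Fin n → Carrier M) →
     Σ (Carrier B → Carrier M) λ φ → IsHom B M φ × (∀ i → Lattice._≈_ M (φ (g i)) (c i)))

data Formula (m : ℕ) : Set where
  _≐_  : Term m → Term m → Formula m
  ⊥f   : Formula m
  _⇒_  : Formula m → Formula m → Formula m
  _∧f_ : Formula m → Formula m → Formula m
  _∨f_ : Formula m → Formula m → Formula m
  ∀f   : Formula (suc m) → Formula m
  ∃f   : Formula (suc m) → Formula m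

Sat : (L : Lat) {m : ℕ} → Formula m → (Fin m → Carrier L) → Set
Sat L (t ≐ s)  ρ = Lattice._≈_ L (eval L ρ t) (eval L ρ s)
Sat L ⊥f       ρ = ⊥
Sat L (φ ⇒ ψ)  ρ = Sat L φ ρ → Sat L ψ ρ
Sat L (φ ∧f ψ) ρ = Sat L φ ρ × Sat L ψ ρ
Sat L (φ ∨f ψ) ρ = Sat L φ ρ ⊎ Sat L ψ ρ
Sat L (∀f φ)   ρ = (x : Carrier L) → Sat L φ (x ∷ᵥ ρ)
Sat L (∃f φ)   ρ = Σ (Carrier L) λ x → Sat L φ (x ∷ᵥ ρ)

IsElementaryEmbedding : (M K : Lat) → (Carrier M → Carrier K) → Set
IsElementaryEmbedding M K ι = IsHom M K ι ×
  (∀ (m : ℕ) (φ : Formula m) (ρ : Fin m → Carrier M) →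
     (Sat M φ ρ → Sat K φ (ι ∘ ρ)) × (Sat K φ (ι ∘ ρ) → Sat M φ ρ))

-- The extension  \hat f : K → L  of  f = eval L a : F_n → L.
-- IsHat ... fh : there are β α : L → F_n with f⁻¹(b) = [β b, α b] in F_n,
-- and fh u ≈ b  iff  ι(β b) ≤ u ≤ ι(α b) in K.

IsHat : (n : ℕ) (K : Lat) (ι : Term n → Carrier K) (L : Lat) (a : Fin n → Carrier L)
        → (Carrier K → Carrier L) → Set
IsHat n K ι L a fh =
  Σ (Carrier L → Term n) λ β → Σ (Carrier L → Term n) λ α →
    (∀ b (t : Term n) →
       (Lattice._≈_ L (eval L a t) b → (β b ≤⟨ F ⟩ t) × (t ≤⟨ F ⟩ α b))
     × ((β b ≤⟨ F ⟩ t) × (t ≤⟨ F ⟩ α b) → Lattice._≈_ L (eval L a t) b))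
  × (∀ u b →
       (Lattice._≈_ L (fh u) b → (ι (β b) ≤⟨ K ⟩ u) × (u ≤⟨ K ⟩ ι (α b)))
     × ((ι (β b) ≤⟨ K ⟩ u) × (u ≤⟨ K ⟩ ι (α b)) → Lattice._≈_ L (fh u) b))
  where F = FreeLattice n

-- Inverse limit of a system (B k , f k<ℓ) of lattices, with the pointwise
-- lattice operations; requires the bonding maps to be homomorphisms.

module _ (B : ℕ → Lat)
         (f : ∀ {k ℓ} → k < ℓ → Carrier (B ℓ) → Carrier (B k))
         (fhom : ∀ {k ℓ} (p : k < ℓ) → IsHom (B ℓ) (B k) (f p)) where

  Thread : Set
  Thread = Σ (∀ k → Carrier (B k)) λ x →
    ∀ {k ℓ} (p : k < ℓ) → Lattice._≈_ (B k) (f p (x ℓ)) (x k)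

  InverseLimit : Lat
  InverseLimit = record
    { Carrier = Thread
    ; _≈_ = λ x y → ∀ k → Lattice._≈_ (B k) (proj₁ x k) (proj₁ y k)
    ; _∨_ = λ x y → (λ k → Lattice._∨_ (B k) (proj₁ x k) (proj₁ y k))
                  , λ {k} p → Lattice.trans (B k) (H.∨-homo p _ _)
                               (Lattice.∨-cong (B k) (proj₂ x p) (proj₂ y p))
    ; _∧_ = λ x y → (λ k → Lattice._∧_ (B k) (proj₁ x k) (proj₁ y k))
                  , λ {k} p → Lattice.trans (B k) (H.∧-homo p _ _)
                               (Lattice.∧-cong (B k) (proj₂ x p) (proj₂ y p))
    ; isLattice = record
      { isEquivalence = record
        { refl = λ k → Lattice.refl (B k)
        ; sym = λ e k → Lattice.sym (B k) (e k)
        ; trans = λ e e' k → Lattice.trans (B k) (e k) (e' k) }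
      ; ∨-comm = λ x y k → Lattice.∨-comm (B k) _ _
      ; ∨-assoc = λ x y z k → Lattice.∨-assoc (B k) _ _ _
      ; ∨-cong = λ e e' k → Lattice.∨-cong (B k) (e k) (e' k)
      ; ∧-comm = λ x y k → Lattice.∧-comm (B k) _ _
      ; ∧-assoc = λ x y z k → Lattice.∧-assoc (B k) _ _ _
      ; ∧-cong = λ e e' k → Lattice.∧-cong (B k) (e k) (e' k)
      ; absorptive = (λ x y k → proj₁ (Lattice.absorptive (B k)) _ _)
                   , (λ x y k → proj₂ (Lattice.absorptive (B k)) _ _)
      }
    }
    where
      module H {k ℓ} (p : k < ℓ) = LatticeMorphisms.IsLatticeHomomorphism (fhom p)

  π : ∀ k → Thread → Carrier (B k)
  π k x = proj₁ x k

{-# OPTIONS --safe #-}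

-- Boundedness of f : F_n → L makes every fibre f⁻¹(b) an interval [β b, α b].
-- As L is finite, "every element lies in one of the intervals [β b, α b]" is a
-- first-order sentence with parameters, so it holds in K and defines \hat f.
-- Since ι reflects the order, the K-interval of an element u has its endpoints in
-- the fibre of \hat f u; hence [β b, α b] ∨ [β c, α c] ⊆ [β (b ∨ c), α (b ∨ c)] in
-- F_n transfers to u ∨ v, making \hat f a homomorphism, and the same argument with
-- a map p satisfying p ∘ f = f′ gives p ∘ \hat f = \hat f′, i.e. the cone property.

module Submission where

open import Defs
open import Data.Nat using (ℕ; _≤_; _<_)
open import Data.Fin using (Fin)
open import Data.Product using (Σ; _×_)
open import Algebra.Lattice.Bundles using (Lattice)
open Lattice using (Carrier)

import Data.Nat as ℕ
open import Data.Nat using (_+_)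
open import Data.Fin using (zero; suc; _↑ˡ_; _↑ʳ_; #_)
open import Data.Product using (_,_; proj₁; proj₂)
open import Data.Sum using (inj₁; inj₂)
open import Data.Empty using (⊥-elim)
open import Data.Vec.Functional using (_++_) renaming (_∷_ to _∷ᵥ_; [] to []ᵥ)
open import Data.Vec.Functional.Properties using (lookup-++ˡ; lookup-++ʳ)
open import Function using (_∘_; flip)
open import Relation.Binary.PropositionalEquality as ≡ using (subst₂)
open import Algebra.Lattice.Morphism.Structures using (module LatticeMorphisms)
import Algebra.Lattice.Properties.Lattice as LatticeProperties
import Relation.Binary.Lattice as OrderTheoretic
import Relation.Binary.Lattice.Properties.JoinSemilattice as JoinSemilatticeProperties
import Relation.Binary.Lattice.Properties.MeetSemilattice as MeetSemilatticeProperties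

module Order (L : Lat) where
  open Lattice L hiding (Carrier)
  private
    module O = OrderTheoretic.Lattice (LatticeProperties.∨-∧-orderTheoreticLattice L)
    module J = JoinSemilatticeProperties O.joinSemilattice
    module M = MeetSemilatticeProperties O.meetSemilattice

  -- The library order is x ≈ x ∧ y, the symmetric form of Leq.
  ≤-reflexive : ∀ {x y} → x ≈ y → x ≤⟨ L ⟩ y
  ≤-reflexive x≈y = sym (O.reflexive x≈y)

  ≤-refl : ∀ {x} → x ≤⟨ L ⟩ x
  ≤-refl = ≤-reflexive refl

  ≤-trans : ∀ {x y z} → x ≤⟨ L ⟩ y → y ≤⟨ L ⟩ z → x ≤⟨ L ⟩ z
  ≤-trans x≤y y≤z = sym (O.trans (sym x≤y) (sym y≤z))

  ≤-antisym : ∀ {x y} → x ≤⟨ L ⟩ y → y ≤⟨ L ⟩ x → x ≈ y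
  ≤-antisym x≤y y≤x = O.antisym (sym x≤y) (sym y≤x)

  ∨-monotonic : ∀ {x x′ y y′} → x ≤⟨ L ⟩ x′ → y ≤⟨ L ⟩ y′ → (x ∨ y) ≤⟨ L ⟩ (x′ ∨ y′)
  ∨-monotonic x≤x′ y≤y′ = sym (J.∨-monotonic (sym x≤x′) (sym y≤y′))

  ∧-monotonic : ∀ {x x′ y y′} → x ≤⟨ L ⟩ x′ → y ≤⟨ L ⟩ y′ → (x ∧ y) ≤⟨ L ⟩ (x′ ∧ y′)
  ∧-monotonic x≤x′ y≤y′ = sym (M.∧-monotonic (sym x≤x′) (sym y≤y′))

  ≤ᵈ⇒≥ : ∀ {x y} → x ≤⟨ dual L ⟩ y → y ≤⟨ L ⟩ x
  ≤ᵈ⇒≥ {x} {y} x∨y≈x = ≤-trans (sym (O.y≤x∨y x y)) (≤-reflexive x∨y≈x)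

  ≥⇒≤ᵈ : ∀ {x y} → y ≤⟨ L ⟩ x → x ≤⟨ dual L ⟩ y
  ≥⇒≤ᵈ {x} {y} y≤x = trans (∨-comm x y) (J.x≤y⇒x∨y≈y (sym y≤x))

isHom⇒monotone : ∀ {M L : Lat} {f : Carrier M → Carrier L} → IsHom M L f →
                 ∀ {x y} → x ≤⟨ M ⟩ y → f x ≤⟨ L ⟩ f y
isHom⇒monotone {L = L} f-hom {x} {y} x∧y≈x =
  Lattice.trans L (Lattice.sym L (∧-homo x y)) (⟦⟧-cong x∧y≈x)
  where open LatticeMorphisms.IsLatticeHomomorphism f-hom

Between : (L : Lat) → Carrier L → Carrier L → Carrier L → Set
Between L lo hi x = lo ≤⟨ L ⟩ x × x ≤⟨ L ⟩ hi

syntax Between L lo hi x = x ∈[ lo , hi ]⟨ L ⟩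

HasIntervalFibres : (M L : Lat) → (Carrier M → Carrier L) → (lo hi : Carrier L → Carrier M) → Set
HasIntervalFibres M L f lo hi = ∀ b x →
  (Lattice._≈_ L (f x) b → x ∈[ lo b , hi b ]⟨ M ⟩)
  × (x ∈[ lo b , hi b ]⟨ M ⟩ → Lattice._≈_ L (f x) b)

module IntervalFibres {M L : Lat} {f : Carrier M → Carrier L} {lo hi : Carrier L → Carrier M}
                      (fibres : HasIntervalFibres M L f lo hi) where
  open Lattice L using (_≈_)
  open Order M using (≤-refl)

  fibre⇒interval : ∀ {b x} → f x ≈ b → x ∈[ lo b , hi b ]⟨ M ⟩
  fibre⇒interval {b} {x} = proj₁ (fibres b x)

  interval⇒fibre : ∀ {b x} → x ∈[ lo b , hi b ]⟨ M ⟩ → f x ≈ b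
  interval⇒fibre {b} {x} = proj₂ (fibres b x)

  lo∈fibre : ∀ {b} → lo b ≤⟨ M ⟩ hi b → f (lo b) ≈ b
  lo∈fibre lo≤hi = interval⇒fibre (≤-refl , lo≤hi)

  hi∈fibre : ∀ {b} → lo b ≤⟨ M ⟩ hi b → f (hi b) ≈ b
  hi∈fibre lo≤hi = interval⇒fibre (lo≤hi , ≤-refl)

boundedHom⇒intervalFibres : ∀ {M L : Lat} {f : Carrier M → Carrier L} → IsHom M L f →
  (∀ b → Σ (Carrier M) λ x → Lattice._≈_ L (f x) b) →
  LowerBoundedHom M L f → UpperBoundedHom M L f →
  Σ (Carrier L → Carrier M) λ lo → Σ (Carrier L → Carrier M) λ hi → HasIntervalFibres M L f lo hi
boundedHom⇒intervalFibres {M} {L} {f} f-hom surjective lower upper =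
  proj₁ ∘ least , proj₁ ∘ greatest , fibres
  where
    open Lattice L using (_≈_; sym)
    open Order L
    open Order M using () renaming (≤ᵈ⇒≥ to ≤ᵈ⇒≥ᴹ)

    f-monotone : ∀ {x y} → x ≤⟨ M ⟩ y → f x ≤⟨ L ⟩ f y
    f-monotone = isHom⇒monotone {M} {L} f-hom

    least : ∀ b → Σ (Carrier M) λ x₀ → b ≤⟨ L ⟩ f x₀ × (∀ x → b ≤⟨ L ⟩ f x → x₀ ≤⟨ M ⟩ x)
    least b with lower b
    ... | inj₂ x₀ = x₀
    ... | inj₁ nothing-above =
      ⊥-elim (nothing-above (proj₁ (surjective b)) (≤-reflexive (sym (proj₂ (surjective b)))))

    greatest : ∀ b → Σ (Carrier M) λ x₀ → f x₀ ≤⟨ L ⟩ b × (∀ x → f x ≤⟨ L ⟩ b → x ≤⟨ M ⟩ x₀)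
    greatest b with upper b
    ... | inj₂ (x₀ , fx₀≤b , below) = x₀ , ≤ᵈ⇒≥ fx₀≤b , λ x fx≤b → ≤ᵈ⇒≥ᴹ (below x (≥⇒≤ᵈ fx≤b))
    ... | inj₁ nothing-below =
      ⊥-elim (nothing-below (proj₁ (surjective b)) (≥⇒≤ᵈ (≤-reflexive (proj₂ (surjective b)))))

    fibres : HasIntervalFibres M L f (proj₁ ∘ least) (proj₁ ∘ greatest)
    fibres b x = fibre⇒interval , interval⇒fibre
      where
        fibre⇒interval : f x ≈ b → x ∈[ proj₁ (least b) , proj₁ (greatest b) ]⟨ M ⟩
        fibre⇒interval fx≈b = proj₂ (proj₂ (least b)) x (≤-reflexive (sym fx≈b))
                            , proj₂ (proj₂ (greatest b)) x (≤-reflexive fx≈b)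

        interval⇒fibre : x ∈[ proj₁ (least b) , proj₁ (greatest b) ]⟨ M ⟩ → f x ≈ b
        interval⇒fibre (lo≤x , x≤hi) =
          ≤-antisym (≤-trans (f-monotone x≤hi) (proj₁ (proj₂ (greatest b))))
                    (≤-trans (proj₁ (proj₂ (least b))) (f-monotone lo≤x))

eval-cong : ∀ (L : Lat) {n} (a : Fin n → Carrier L) {s t : Term n} → s ≃ t →
            Lattice._≈_ L (eval L a s) (eval L a t)
eval-cong L a ≃-refl           = Lattice.refl L
eval-cong L a (≃-sym p)        = Lattice.sym L (eval-cong L a p)
eval-cong L a (≃-trans p q)    = Lattice.trans L (eval-cong L a p) (eval-cong L a q)
eval-cong L a (≃∨-comm _ _)    = Lattice.∨-comm L _ _
eval-cong L a (≃∨-assoc _ _ _) = Lattice.∨-assoc L _ _ _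
eval-cong L a (≃∨-cong p q)    = Lattice.∨-cong L (eval-cong L a p) (eval-cong L a q)
eval-cong L a (≃∧-comm _ _)    = Lattice.∧-comm L _ _
eval-cong L a (≃∧-assoc _ _ _) = Lattice.∧-assoc L _ _ _
eval-cong L a (≃∧-cong p q)    = Lattice.∧-cong L (eval-cong L a p) (eval-cong L a q)
eval-cong L a (≃∨-abs-∧ _ _)   = proj₁ (Lattice.absorptive L) _ _
eval-cong L a (≃∧-abs-∨ _ _)   = proj₂ (Lattice.absorptive L) _ _

eval-isHom : ∀ (L : Lat) {n} (a : Fin n → Carrier L) → IsHom (FreeLattice n) L (eval L a)
eval-isHom L a = record
  { isRelHomomorphism = record { cong = eval-cong L a }
  ; ∧-homo = λ _ _ → Lattice.refl L
  ; ∨-homo = λ _ _ → Lattice.refl L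
  }

eval-var : ∀ {n} (t : Term n) → eval (FreeLattice n) var t ≃ t
eval-var (var i)  = ≃-refl
eval-var (t ∨ₜ s) = ≃∨-cong (eval-var t) (eval-var s)
eval-var (t ∧ₜ s) = ≃∧-cong (eval-var t) (eval-var s)

FreeLattice-finitelyGenerated : ∀ n → FinitelyGenerated (FreeLattice n)
FreeLattice-finitelyGenerated n = n , var , λ t → t , eval-var t

eval-natural : ∀ {L L′ : Lat} {n} {p : Carrier L → Carrier L′} → IsHom L L′ p →
  {a : Fin n → Carrier L} {a′ : Fin n → Carrier L′} → (∀ i → Lattice._≈_ L′ (p (a i)) (a′ i)) →
  ∀ t → Lattice._≈_ L′ (p (eval L a t)) (eval L′ a′ t)
eval-natural {L′ = L′} {p = p} p-hom {a} {a′} p∘a≈a′ = natural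
  where
    open LatticeMorphisms.IsLatticeHomomorphism p-hom

    natural : ∀ t → Lattice._≈_ L′ (p (eval _ a t)) (eval L′ a′ t)
    natural (var i)  = p∘a≈a′ i
    natural (t ∨ₜ s) = Lattice.trans L′ (∨-homo _ _) (Lattice.∨-cong L′ (natural t) (natural s))
    natural (t ∧ₜ s) = Lattice.trans L′ (∧-homo _ _) (Lattice.∧-cong L′ (natural t) (natural s))

infix 5 _≤ᶠ_
_≤ᶠ_ : ∀ {m} → Term m → Term m → Formula m
s ≤ᶠ t = (s ∧ₜ t) ≐ s

_∈ᶠ[_,_] : ∀ {m} → Term m → Term m → Term m → Formula m
x ∈ᶠ[ lo , hi ] = (lo ≤ᶠ x) ∧f (x ≤ᶠ hi)

⋁ᶠ : ∀ {m} k → (Fin k → Formula m) → Formula m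
⋁ᶠ ℕ.zero    φ = ⊥f
⋁ᶠ (ℕ.suc k) φ = φ zero ∨f ⋁ᶠ k (φ ∘ suc)

module _ (L : Lat) {m} (ρ : Fin m → Carrier L) where
  ⋁ᶠ-intro : ∀ {k} (φ : Fin k → Formula m) i → Sat L (φ i) ρ → Sat L (⋁ᶠ k φ) ρ
  ⋁ᶠ-intro φ zero    sat = inj₁ sat
  ⋁ᶠ-intro φ (suc i) sat = inj₂ (⋁ᶠ-intro (φ ∘ suc) i sat)

  ⋁ᶠ-elim : ∀ {k} (φ : Fin k → Formula m) → Sat L (⋁ᶠ k φ) ρ → Σ (Fin k) λ i → Sat L (φ i) ρ
  ⋁ᶠ-elim {ℕ.suc k} φ (inj₁ sat) = zero , sat
  ⋁ᶠ-elim {ℕ.suc k} φ (inj₂ sat) = let i , satᵢ = ⋁ᶠ-elim (φ ∘ suc) sat in suc i , satᵢ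

module ElementaryExtension {M K : Lat} {ι : Carrier M → Carrier K}
                           (E : IsElementaryEmbedding M K ι) where
  open Order K using (≤-reflexive; ≤-trans)

  ι-isHom : IsHom M K ι
  ι-isHom = proj₁ E

  ι-monotone : ∀ {x y} → x ≤⟨ M ⟩ y → ι x ≤⟨ K ⟩ ι y
  ι-monotone = isHom⇒monotone {M} {K} ι-isHom

  preserve : ∀ {m} (φ : Formula m) ρ → Sat M φ ρ → Sat K φ (ι ∘ ρ)
  preserve φ ρ = proj₁ (proj₂ E _ φ ρ)

  reflect : ∀ {m} (φ : Formula m) ρ → Sat K φ (ι ∘ ρ) → Sat M φ ρ
  reflect φ ρ = proj₂ (proj₂ E _ φ ρ)

  ι-reflects-≤ : ∀ {x y} → ι x ≤⟨ K ⟩ ι y → x ≤⟨ M ⟩ y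
  ι-reflects-≤ {x} {y} = reflect (var (# 0) ≤ᶠ var (# 1)) (x ∷ᵥ y ∷ᵥ []ᵥ)

  interval-nonempty : ∀ {u a b} → u ∈[ ι a , ι b ]⟨ K ⟩ → a ≤⟨ M ⟩ b
  interval-nonempty (ιa≤u , u≤ιb) = ι-reflects-≤ (≤-trans ιa≤u u≤ιb)

  intervals-meet : ∀ {u a b c d} → u ∈[ ι a , ι b ]⟨ K ⟩ → u ∈[ ι c , ι d ]⟨ K ⟩ →
                   Σ (Carrier M) λ x → x ∈[ a , b ]⟨ M ⟩ × x ∈[ c , d ]⟨ M ⟩
  intervals-meet {u} {a} {b} {c} {d} u∈ab u∈cd =
    reflect (∃f ((var (# 0) ∈ᶠ[ var (# 1) , var (# 2) ]) ∧f (var (# 0) ∈ᶠ[ var (# 3) , var (# 4) ])))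
      (a ∷ᵥ b ∷ᵥ c ∷ᵥ d ∷ᵥ []ᵥ) (u , u∈ab , u∈cd)

  interval-cover : ∀ {m} (lo hi : Fin m → Carrier M) →
    (∀ x → Σ (Fin m) λ i → x ∈[ lo i , hi i ]⟨ M ⟩) →
    ∀ u → Σ (Fin m) λ i → u ∈[ ι (lo i) , ι (hi i) ]⟨ K ⟩
  interval-cover {m} lo hi covered u =
    let i , u∈ᵢ = ⋁ᶠ-elim K (u ∷ᵥ ι ∘ (lo ++ hi)) memberᶠ (preserve coverᶠ (lo ++ hi) coveredᴹ u)
    in i , subst₂ (λ l h → u ∈[ l , h ]⟨ K ⟩)
                  (≡.cong ι (lookup-++ˡ lo hi i)) (≡.cong ι (lookup-++ʳ lo hi i)) u∈ᵢ
    where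
      memberᶠ : Fin m → Formula (ℕ.suc (m + m))
      memberᶠ i = var zero ∈ᶠ[ var (suc (i ↑ˡ m)) , var (suc (m ↑ʳ i)) ]

      coverᶠ : Formula (m + m)
      coverᶠ = ∀f (⋁ᶠ m memberᶠ)

      coveredᴹ : Sat M coverᶠ (lo ++ hi)
      coveredᴹ x =
        let i , x∈ᵢ = covered x
        in ⋁ᶠ-intro M (x ∷ᵥ lo ++ hi) memberᶠ i
             (subst₂ (λ l h → x ∈[ l , h ]⟨ M ⟩)
                     (≡.sym (lookup-++ˡ lo hi i)) (≡.sym (lookup-++ʳ lo hi i)) x∈ᵢ)

  module Extension {L : Lat} {f : Carrier M → Carrier L} {lo hi : Carrier L → Carrier M}
                   (f-fibres : HasIntervalFibres M L f lo hi)
                   {h : Carrier K → Carrier L} (h-fibres : HasIntervalFibres K L h (ι ∘ lo) (ι ∘ hi))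
                   where
    open Lattice L using (_≈_; sym; trans)
    open Order K using (∨-monotonic; ∧-monotonic)
    open IntervalFibres {M} {L} f-fibres using (fibre⇒interval; lo∈fibre; hi∈fibre)
    open IntervalFibres {K} {L} h-fibres using () renaming (fibre⇒interval to h-fibre⇒interval;
                                                    interval⇒fibre to h-interval⇒fibre)

    ∈h-fibre : ∀ u → u ∈[ ι (lo (h u)) , ι (hi (h u)) ]⟨ K ⟩
    ∈h-fibre u = h-fibre⇒interval (Lattice.refl L)

    lo∈f-fibre : ∀ u → f (lo (h u)) ≈ h u
    lo∈f-fibre u = lo∈fibre (interval-nonempty (∈h-fibre u))

    hi∈f-fibre : ∀ u → f (hi (h u)) ≈ h u
    hi∈f-fibre u = hi∈fibre (interval-nonempty (∈h-fibre u))

    h-cong : ∀ {u v} → Lattice._≈_ K u v → h u ≈ h v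
    h-cong {u} {v} u≈v =
      let lo≤u , u≤hi = ∈h-fibre u
      in sym (h-interval⇒fibre ( ≤-trans lo≤u (≤-reflexive u≈v)
                               , ≤-trans (≤-reflexive (Lattice.sym K u≈v)) u≤hi))

    h-preserves : (_∙ᴹ_ : Carrier M → Carrier M → Carrier M) (_∙ᴷ_ : Carrier K → Carrier K → Carrier K)
      (_∙ᴸ_ : Carrier L → Carrier L → Carrier L) →
      (∀ {u u′ v v′} → u ≤⟨ K ⟩ u′ → v ≤⟨ K ⟩ v′ → (u ∙ᴷ v) ≤⟨ K ⟩ (u′ ∙ᴷ v′)) →
      (∀ {b b′ c c′} → b ≈ b′ → c ≈ c′ → (b ∙ᴸ c) ≈ (b′ ∙ᴸ c′)) →
      (∀ x y → Lattice._≈_ K (ι (x ∙ᴹ y)) (ι x ∙ᴷ ι y)) →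
      (∀ x y → f (x ∙ᴹ y) ≈ (f x ∙ᴸ f y)) →
      ∀ u v → h (u ∙ᴷ v) ≈ (h u ∙ᴸ h v)
    h-preserves _∙ᴹ_ _∙ᴷ_ _∙ᴸ_ ∙ᴷ-monotonic ∙ᴸ-cong ι-homo f-homo u v =
      h-interval⇒fibre (lo-below , hi-above)
      where
        f-fibre-∙ : ∀ {x y} → f x ≈ h u → f y ≈ h v → f (x ∙ᴹ y) ≈ (h u ∙ᴸ h v)
        f-fibre-∙ fx≈hu fy≈hv = trans (f-homo _ _) (∙ᴸ-cong fx≈hu fy≈hv)

        lo-below : ι (lo (h u ∙ᴸ h v)) ≤⟨ K ⟩ (u ∙ᴷ v)
        lo-below = ≤-trans (ι-monotone (proj₁ (fibre⇒interval lo∙lo∈fibre)))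
                   (≤-trans (≤-reflexive (ι-homo _ _))
                            (∙ᴷ-monotonic (proj₁ (∈h-fibre u)) (proj₁ (∈h-fibre v))))
          where lo∙lo∈fibre = f-fibre-∙ (lo∈f-fibre u) (lo∈f-fibre v)

        hi-above : (u ∙ᴷ v) ≤⟨ K ⟩ ι (hi (h u ∙ᴸ h v))
        hi-above = ≤-trans (∙ᴷ-monotonic (proj₂ (∈h-fibre u)) (proj₂ (∈h-fibre v)))
                   (≤-trans (≤-reflexive (Lattice.sym K (ι-homo _ _)))
                            (ι-monotone (proj₂ (fibre⇒interval hi∙hi∈fibre))))
          where hi∙hi∈fibre = f-fibre-∙ (hi∈f-fibre u) (hi∈f-fibre v)

    h-isHom : IsHom M L f → IsHom K L h
    h-isHom f-hom = record
      { isRelHomomorphism = record { cong = h-cong }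
      ; ∧-homo = h-preserves _ _ _ ∧-monotonic (Lattice.∧-cong L) ι.∧-homo f.∧-homo
      ; ∨-homo = h-preserves _ _ _ ∨-monotonic (Lattice.∨-cong L) ι.∨-homo f.∨-homo
      }
      where
        module ι = LatticeMorphisms.IsLatticeHomomorphism ι-isHom
        module f = LatticeMorphisms.IsLatticeHomomorphism f-hom

    h∘ι≈f : ∀ x → h (ι x) ≈ f x
    h∘ι≈f x = let lo≤x , x≤hi = fibre⇒interval (Lattice.refl L)
              in h-interval⇒fibre (ι-monotone lo≤x , ι-monotone x≤hi)

  module _ {L : Lat} {f : Carrier M → Carrier L} {lo hi : Carrier L → Carrier M}
           (f-fibres : HasIntervalFibres M L f lo hi) where
    open Lattice L using (_≈_; sym; trans)
    open IntervalFibres {M} {L} f-fibres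

    intervalFibres-extend : Finite L → (∀ b → Σ (Carrier M) λ x → f x ≈ b) →
      Σ (Carrier K → Carrier L) λ h → HasIntervalFibres K L h (ι ∘ lo) (ι ∘ hi)
    intervalFibres-extend (m , e , enumerates) surjective = h , h-fibres
      where
        covered : ∀ x → Σ (Fin m) λ i → x ∈[ lo (e i) , hi (e i) ]⟨ M ⟩
        covered x = let i , eᵢ≈fx = enumerates (f x) in i , fibre⇒interval (sym eᵢ≈fx)

        choice : ∀ u → Σ (Fin m) λ i → u ∈[ ι (lo (e i)) , ι (hi (e i)) ]⟨ K ⟩
        choice = interval-cover (lo ∘ e) (hi ∘ e) covered

        h : Carrier K → Carrier L
        h u = e (proj₁ (choice u))

        lo≤hi : ∀ b → lo b ≤⟨ M ⟩ hi b
        lo≤hi b = let x , fx≈b = surjective b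
                      lo≤x , x≤hi = fibre⇒interval fx≈b
                  in Order.≤-trans M lo≤x x≤hi

        h-fibres : HasIntervalFibres K L h (ι ∘ lo) (ι ∘ hi)
        h-fibres b u = fibre⇒interval-in-K , interval-in-K⇒fibre
          where
            u∈h-fibre : u ∈[ ι (lo (h u)) , ι (hi (h u)) ]⟨ K ⟩
            u∈h-fibre = proj₂ (choice u)

            fibre⇒interval-in-K : h u ≈ b → u ∈[ ι (lo b) , ι (hi b) ]⟨ K ⟩
            fibre⇒interval-in-K hu≈b =
              ≤-trans (ι-monotone (proj₁ (fibre⇒interval (trans (lo∈fibre (lo≤hi (h u))) hu≈b))))
                      (proj₁ u∈h-fibre)
              , ≤-trans (proj₂ u∈h-fibre)
                        (ι-monotone (proj₂ (fibre⇒interval (trans (hi∈fibre (lo≤hi (h u))) hu≈b))))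

            interval-in-K⇒fibre : u ∈[ ι (lo b) , ι (hi b) ]⟨ K ⟩ → h u ≈ b
            interval-in-K⇒fibre u∈b =
              let x , x∈hu , x∈b = intervals-meet u∈h-fibre u∈b
              in trans (sym (interval⇒fibre x∈hu)) (interval⇒fibre x∈b)

    extensions-commute :
      ∀ {h : Carrier K → Carrier L} → HasIntervalFibres K L h (ι ∘ lo) (ι ∘ hi) →
      ∀ {L′ : Lat} {f′ : Carrier M → Carrier L′} {lo′ hi′ : Carrier L′ → Carrier M} →
      HasIntervalFibres M L′ f′ lo′ hi′ →
      ∀ {h′ : Carrier K → Carrier L′} → HasIntervalFibres K L′ h′ (ι ∘ lo′) (ι ∘ hi′) →
      ∀ {p : Carrier L → Carrier L′} → (∀ {b c} → b ≈ c → Lattice._≈_ L′ (p b) (p c)) →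
      (∀ x → Lattice._≈_ L′ (p (f x)) (f′ x)) →
      ∀ u → Lattice._≈_ L′ (p (h u)) (h′ u)
    extensions-commute {h} h-fibres {L′} {f′} f′-fibres h′-fibres {p} p-cong p∘f≈f′ u =
      Lattice.sym L′ (h′.interval⇒fibre
        ( ≤-trans (ι-monotone (proj₁ (f′.fibre⇒interval (f′-image (E.lo∈f-fibre u)))))
                  (proj₁ (E.∈h-fibre u))
        , ≤-trans (proj₂ (E.∈h-fibre u))
                  (ι-monotone (proj₂ (f′.fibre⇒interval (f′-image (E.hi∈f-fibre u)))))))
      where
        module E  = Extension {L} f-fibres h-fibres
        module f′ = IntervalFibres {M} {L′} f′-fibres
        module h′ = IntervalFibres {K} {L′} h′-fibres

        f′-image : ∀ {x} → f x ≈ h u → Lattice._≈_ L′ (f′ x) (p (h u))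
        f′-image fx≈hu = Lattice.trans L′ (Lattice.sym L′ (p∘f≈f′ _)) (p-cong fx≈hu)

module _ (B : ℕ → Lat)
         (f : ∀ {k ℓ} → k < ℓ → Carrier (B ℓ) → Carrier (B k))
         (f-hom : ∀ {k ℓ} (p : k < ℓ) → IsHom (B ℓ) (B k) (f p)) where

  cone⇒InverseLimit-hom : ∀ {K : Lat} (hh : ∀ k → Carrier K → Carrier (B k)) →
    (∀ k → IsHom K (B k) (hh k)) →
    (∀ {k ℓ} (p : k < ℓ) u → Lattice._≈_ (B k) (f p (hh ℓ u)) (hh k u)) →
    Σ (Carrier K → Carrier (InverseLimit B f f-hom)) λ h →
      IsHom K (InverseLimit B f f-hom) h
      × (∀ k u → Lattice._≈_ (B k) (π B f f-hom k (h u)) (hh k u))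
  cone⇒InverseLimit-hom hh hh-hom cone =
    (λ u → (λ k → hh k u) , λ p → cone p u)
    , record
      { isRelHomomorphism = record { cong = λ u≈v k → hom.⟦⟧-cong k u≈v }
      ; ∧-homo = λ u v k → hom.∧-homo k u v
      ; ∨-homo = λ u v k → hom.∨-homo k u v
      }
    , λ k u → Lattice.refl (B k)
    where
      module hom k = LatticeMorphisms.IsLatticeHomomorphism (hh-hom k)

module _ {n} {K : Lat} {ι : Term n → Carrier K} (E : IsElementaryEmbedding (FreeLattice n) K ι) where
  open ElementaryExtension E

  isHat⇒isHom : ∀ {L : Lat} {a : Fin n → Carrier L} {h : Carrier K → Carrier L} →
                IsHat n K ι L a h → IsHom K L h
  isHat⇒isHom {L} {a} (_ , _ , f-fibres , h-fibres) =
    Extension.h-isHom {L} f-fibres (flip h-fibres) (eval-isHom L a)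

  isHat-commute : ∀ {L L′ : Lat} {a : Fin n → Carrier L} {a′ : Fin n → Carrier L′}
    {h : Carrier K → Carrier L} {h′ : Carrier K → Carrier L′} →
    IsHat n K ι L a h → IsHat n K ι L′ a′ h′ →
    ∀ {p : Carrier L → Carrier L′} → IsHom L L′ p → (∀ i → Lattice._≈_ L′ (p (a i)) (a′ i)) →
    ∀ u → Lattice._≈_ L′ (p (h u)) (h′ u)
  isHat-commute {L} {L′} (_ , _ , f-fibres , h-fibres) (_ , _ , f′-fibres , h′-fibres) p-hom p∘a≈a′ =
    extensions-commute {L} f-fibres (flip h-fibres) {L′} f′-fibres (flip h′-fibres)
      (LatticeMorphisms.IsLatticeHomomorphism.⟦⟧-cong p-hom) (eval-natural {L} {L′} p-hom p∘a≈a′)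

lemma4p8 : (n : ℕ) → 1 ≤ n →
  (K : Lat) (ι : Term n → Carrier K) → IsElementaryEmbedding (FreeLattice n) K ι →
  -- part 1: every finite bounded lattice L generated by a_1..a_n
  (∀ (L : Lat) (a : Fin n → Carrier L) → Finite L → GeneratedBy L a →
     LowerBoundedLat L → UpperBoundedLat L →
     Σ (Carrier K → Carrier L) λ fh →
       IsHat n K ι L a fh × IsHom K L fh
       × (∀ (t : Term n) → Lattice._≈_ L (fh (ι t)) (eval L a t)))
  ×
  -- part 2: the maps \hat h_k form a cone and factor through H_n
  (∀ (B : ℕ → Lat) (g : ∀ k → Fin n → Carrier (B k)) →
     (∀ k → IsFreeInV k n (B k) (g k)) →
     (f : ∀ {k ℓ} → k < ℓ → Carrier (B ℓ) → Carrier (B k)) →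
     (fhom : ∀ {k ℓ} (p : k < ℓ) → IsHom (B ℓ) (B k) (f p)) →
     (∀ {k ℓ} (p : k < ℓ) (i : Fin n) → Lattice._≈_ (B k) (f p (g ℓ i)) (g k i)) →
     (hh : ∀ k → Carrier K → Carrier (B k)) →
     (∀ k → IsHat n K ι (B k) (g k) (hh k)) →
     (∀ {k ℓ} (p : k < ℓ) (u : Carrier K) → Lattice._≈_ (B k) (f p (hh ℓ u)) (hh k u))
     × Σ (Carrier K → Carrier (InverseLimit B f fhom)) λ h →
         IsHom K (InverseLimit B f fhom) h
         × (∀ k (u : Carrier K) → Lattice._≈_ (B k) (π B f fhom k (h u)) (hh k u)))
lemma4p8 n _ K ι E =
  (λ L a finite generated lower upper →
     let f-hom = eval-isHom L a
         F-fg = FreeLattice-finitelyGenerated n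
         lo , hi , f-fibres = boundedHom⇒intervalFibres {FreeLattice n} {L} f-hom generated
                                (lower (FreeLattice n) F-fg _ f-hom) (upper (FreeLattice n) F-fg _ f-hom)
         h , h-fibres = intervalFibres-extend {L} f-fibres finite generated
     in h , (lo , hi , f-fibres , flip h-fibres)
        , Extension.h-isHom {L} f-fibres h-fibres f-hom , Extension.h∘ι≈f {L} f-fibres h-fibres)
  , λ B g _ f f-hom f-gen hh hats →
     let commute = λ {k} {ℓ} (p : k < ℓ) → isHat-commute E (hats ℓ) (hats k) (f-hom p) (f-gen p)
     in commute , cone⇒InverseLimit-hom B f f-hom {K} hh (λ k → isHat⇒isHom E (hats k)) commute
  where open ElementaryExtension E
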